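{- Let $f,g:\omega\to\{0,1\}$ be distinct. Then $\chi^f\not\preceq\chi^g$.
   Context: A $\{0,1\}$-sequence is a partial function $\alpha:\mathbb Z\to\{0,1\}$ whose domain is an interval of integers. A translation is a map $s:\mathbb Z\to\mathbb Z$, $s(i)=i+k$ for a fixed $k\in\mathbb Z$. For sequences $\alpha,\beta$: $\alpha$ is embedded into $\beta$ ($\alpha\trianglelefteq\beta$) if $\alpha\circ s\subseteq\beta$ (as sets of pairs) for some translation $s$; $\alpha$ is finitely covered by $\beta$ ($\alpha\preceq\beta$) if $\gamma\trianglelefteq\beta$ for every finite sequence $\gamma\subseteq\alpha$. Generalized Thue–Morse sequence: for $f:\omega\to\{0,1\}$ define finite sequences $\chi^f_i$ by: $\chi^f_0$ has domain $\{0,1,2\}$ with values $0,0,1$. If $\chi^f_{2i}$ has domain $[a,b]$, then $\chi^f_{2i+1}$ has domain $[a,2b-a+2]$, agrees with $\chi^f_{2i}$ on $[a,b]$, takes value $f(2i)$ at $b+1$, and value $1-\chi^f_{2i}(a+j)$ at $b+2+j$ for $0\le j\le b-a$. If $\chi^f_{2i+1}$ has domain $[a,b]$ and $L=b-a+1$, then $\chi^f_{2i+2}$ has domain $[a-L-1,b]$, takes value $1-\chi^f_{2i+1}(a+j)$ at $a-L-1+j$ for $0\le j<L$, value $f(2i+1)$ at $a-1$, and agrees with $\chi^f_{2i+1}$ on $[a,b]$. Then $\chi^f=\bigcup_i\chi^f_i$, a total function $\mathbb Z\to\{0,1\}$. -}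

module Defs where

open import Data.Nat using (ℕ; zero; suc)
open import Data.Integer using (ℤ; +_; -[1+_]; _+_; _-_; _≤_; ∣_∣)
import Data.Nat as N
open import Data.Fin using (Fin; zero; suc)
open import Data.List using (List; []; _∷_; _++_; map; length)
open import Data.Maybe using (Maybe; just; nothing; Is-just)
open import Data.Bool using (Bool; true; false; not)
open import Data.Product using (_×_; _,_; ∃; proj₁; proj₂)
open import Relation.Binary.PropositionalEquality using (_≡_)

Bit : Set
Bit = Fin 2

b0 b1 : Bit
b0 = zero
b1 = suc zero

comp : Bit → Bit
comp zero = suc zero
comp (suc _) = zero

PSeq : Set
PSeq = ℤ → Maybe Bit

IntervalDomain : PSeq → Set
IntervalDomain α = ∀ i j k → i ≤ j → j ≤ k →
  Is-just (α i) → Is-just (α k) → Is-just (α j)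

FiniteDomain : PSeq → Set
FiniteDomain α = ∃ λ (N : ℕ) → ∀ z → Is-just (α z) → ∣ z ∣ N.≤ N

FiniteSeq : PSeq → Set
FiniteSeq α = IntervalDomain α × FiniteDomain α

-- A finite sequence stored as (start point a, list of values on [a, a+len-1]).
Block : Set
Block = ℤ × List Bit

listAt : List Bit → ℕ → Maybe Bit
listAt [] _ = nothing
listAt (x ∷ _) zero = just x
listAt (_ ∷ l) (suc n) = listAt l n

blockAt : Block → ℤ → Maybe Bit
blockAt (a , l) z with z - a
... | + n = listAt l n
... | -[1+ _ ] = nothing

isEven : ℕ → Bool
isEven zero = true
isEven (suc n) = not (isEven n)

step : Bit → Bool → Block → Block
-- n = 2i even: chi_{2i+1} = chi_{2i} , f(2i) , complement(chi_{2i}), same start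
step v true (a , l) = a , (l ++ (v ∷ map comp l))
-- n = 2i+1 odd: chi_{2i+2} = complement(chi_{2i+1}) , f(2i+1) , chi_{2i+1}, start a-L-1
step v false (a , l) = (a - + length l - + 1) , (map comp l ++ (v ∷ l))

chiStage : (ℕ → Bit) → ℕ → Block
chiStage f zero = + 0 , (b0 ∷ b0 ∷ b1 ∷ [])
chiStage f (suc n) = step (f n) (isEven n) (chiStage f n)

-- graph of chi^f = ⋃_n chi^f_n, as a set of pairs (z , b)
ChiGraph : (ℕ → Bit) → ℤ → Bit → Set
ChiGraph f z b = ∃ λ (n : ℕ) → blockAt (chiStage f n) z ≡ just b

SubChi : PSeq → (ℕ → Bit) → Set
SubChi α f = ∀ z b → α z ≡ just b → ChiGraph f z b

EmbChi : PSeq → (ℕ → Bit) → Set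
EmbChi α f = ∃ λ (k : ℤ) → ∀ z b → α (z + k) ≡ just b → ChiGraph f z b

-- chi^f ⪯ chi^g : every finite γ ⊆ chi^f embeds into chi^g
FinCovered : (ℕ → Bit) → (ℕ → Bit) → Set
FinCovered f g = ∀ (γ : PSeq) → FiniteSeq γ → SubChi γ f → EmbChi γ g

-- χ^f_m is the word w_{m+2} of the recursion w_0 = [], w_{k+1} = w_k x_k w̄_k or
-- w̄_k x_k w_k, with separators x = 0, 0, f 0, f 1, … (w̄ is the complement).
-- Hence every stage w_N is tiled by copies of w_k and w̄_k starting at the
-- multiples of 2^k, the two halves of a copy of w_{k+1} having opposite
-- polarities. Finite covering puts w^f_{n+4} = χ^f_{n+2} at some offset s inside
-- some w^g_N. Its prefix 001 cannot sit one place away from a tile 001 of w^g_N,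
-- so s is even. If 2^k divides s but 2^{k+1} does not, the tiles w^f_k at
-- positions 2^k and 2^{k+1} of w^f_{k+2}, which have the same polarity, land on
-- the two halves of a tile w^g_{k+1}, which is impossible. So 2^{n+3} divides s:
-- the prefix w^f_{n+3} lands exactly on a tile w^g_{n+3}, and their middle
-- letters give f n = g n.
module Submission where

open import Defs
open import Data.Nat using (ℕ)
open import Relation.Binary.PropositionalEquality using (_≡_)
open import Relation.Nullary using (¬_)

open import Data.Bool using (Bool; true; false; not)
open import Data.Bool.Properties using (not-injective; not-involutive; not-¬)
open import Data.Empty using (⊥-elim)
import Data.Fin as Fin
open import Data.Integer as ℤ using (ℤ; +_; -[1+_]; +≤+)
import Data.Integer.Properties as ℤₚ
import Data.Integer.Tactic.RingSolver as ℤ-Solver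
open import Data.List using (List; []; _∷_; _++_; map; length)
open import Data.List.Properties using (length-++; length-map)
open import Data.Maybe using (Maybe; just; nothing; Is-just)
open import Data.Maybe.Properties using (just-injective)
open import Data.Maybe.Relation.Unary.Any using (just)
open import Data.Nat using (zero; suc; _+_; _*_; _∸_; _^_; _≤_; _<_; _⊔_; z≤n; s≤s; z<s; _<?_; _≤?_)
open import Data.Nat.Divisibility using (_∣_; divides)
open import Data.Nat.Properties
open import Data.Nat.Tactic.RingSolver using (solve-∀)
open import Data.Product using (∃; ∃₂; _×_; _,_; proj₁; proj₂)
open import Data.Sum using (_⊎_; inj₁; inj₂)
open import Data.Unit using (tt)
open import Relation.Binary.PropositionalEquality using (refl; sym; trans; cong; subst; subst₂; module ≡-Reasoning)
open import Relation.Nullary using (yes; no; contradiction)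

variable
  f g v w : ℕ → Bit
  d : ℕ → Bool
  W l : List Bit
  x y b : Bit
  a c e : Bool
  i j m p s M M′ N : ℕ
  z : ℤ

complementIf : Bool → Bit → Bit
complementIf false x = x
complementIf true  x = comp x

flipUnless : Bool → Bool → Bool
flipUnless true  e = e
flipUnless false e = not e

comp-involutive : ∀ x → comp (comp x) ≡ x
comp-involutive Fin.zero           = refl
comp-involutive (Fin.suc Fin.zero) = refl

complementIf-comp : ∀ e x → complementIf e (comp x) ≡ complementIf (not e) x
complementIf-comp false x = refl
complementIf-comp true  x = comp-involutive x

complementIf-injectiveˡ : ∀ x → complementIf a x ≡ complementIf c x → a ≡ c
complementIf-injectiveˡ {false} {false} _                  _  = refl
complementIf-injectiveˡ {true}  {true}  _                  _  = refl
complementIf-injectiveˡ {false} {true}  Fin.zero           ()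
complementIf-injectiveˡ {false} {true}  (Fin.suc Fin.zero) ()
complementIf-injectiveˡ {true}  {false} Fin.zero           ()
complementIf-injectiveˡ {true}  {false} (Fin.suc Fin.zero) ()

complementIf-injectiveʳ : ∀ e → complementIf e x ≡ complementIf e y → x ≡ y
complementIf-injectiveʳ false eq = eq
complementIf-injectiveʳ {x} {y} true eq = begin
  x                ≡⟨ sym (comp-involutive x) ⟩
  comp (comp x)    ≡⟨ cong comp eq ⟩
  comp (comp y)    ≡⟨ comp-involutive y ⟩
  y                ∎
  where open ≡-Reasoning

complementIf-flipUnless : ∀ c e x → complementIf e (complementIf (not c) x) ≡ complementIf (flipUnless c e) x
complementIf-flipUnless true  e x = refl
complementIf-flipUnless false e x = complementIf-comp e x

complementIf-not-flipUnless : ∀ c e x → complementIf e (complementIf c x) ≡ complementIf (not (flipUnless c e)) x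
complementIf-not-flipUnless true  e x = complementIf-comp e x
complementIf-not-flipUnless false e x = cong (λ e′ → complementIf e′ x) (sym (not-involutive e))

flipUnless-not : ∀ c e → flipUnless c (not e) ≡ not (flipUnless c e)
flipUnless-not true  e = refl
flipUnless-not false e = refl

flipUnless-injective : ∀ c → flipUnless c a ≡ flipUnless c e → a ≡ e
flipUnless-injective true  eq = eq
flipUnless-injective false eq = not-injective eq

listAt-++ˡ : ∀ l {r} → listAt l j ≡ just b → listAt (l ++ r) j ≡ just b
listAt-++ˡ              []      ()
listAt-++ˡ {j = zero}  (x ∷ l) q = q
listAt-++ˡ {j = suc j} (x ∷ l) q = listAt-++ˡ l q

listAt-++ʳ : ∀ l {r} j → listAt (l ++ r) (length l + j) ≡ listAt r j
listAt-++ʳ []      j = refl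
listAt-++ʳ (x ∷ l) j = listAt-++ʳ l j

listAt-map : ∀ (h : Bit → Bit) l → listAt l j ≡ just b → listAt (map h l) j ≡ just (h b)
listAt-map              h []      ()
listAt-map {j = zero}  h (x ∷ l) refl = refl
listAt-map {j = suc j} h (x ∷ l) q    = listAt-map h l q

listAt-just⇒< : ∀ l → listAt l j ≡ just b → j < length l
listAt-just⇒<              []      ()
listAt-just⇒< {j = zero}  (x ∷ l) _ = z<s
listAt-just⇒< {j = suc j} (x ∷ l) q = s≤s (listAt-just⇒< l q)

<⇒listAt-just : ∀ l → j < length l → ∃ λ b → listAt l j ≡ just b
<⇒listAt-just {j = zero}  (x ∷ l) _        = x , refl
<⇒listAt-just {j = suc j} (x ∷ l) (s≤s j<) = <⇒listAt-just l j<

same-letter : ∀ {u : Maybe Bit} → u ≡ just x → u ≡ just y → x ≡ y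
same-letter p q = just-injective (trans (sym p) q)

-- The words w_m and their occurrences

grow : Bit → Bool → List Bit → List Bit
grow x true  l = l ++ x ∷ map comp l
grow x false l = map comp l ++ x ∷ l

stage : (ℕ → Bit) → (ℕ → Bool) → ℕ → List Bit
stage v d zero    = []
stage v d (suc m) = grow (v m) (d m) (stage v d m)

len : ℕ → ℕ
len zero    = 0
len (suc m) = len m + suc (len m)

period : ℕ → ℕ
period m = suc (len m)

length-grow : ∀ x c l → length (grow x c l) ≡ length l + suc (length l)
length-grow x true  l = trans (length-++ l) (cong (λ k → length l + suc k) (length-map comp l))
length-grow x false l = trans (length-++ (map comp l)) (cong (λ k → k + suc (length l)) (length-map comp l))

length-stage : ∀ v d m → length (stage v d m) ≡ len m
length-stage v d zero    = refl
length-stage v d (suc m) =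
  trans (length-grow (v m) (d m) (stage v d m)) (cong (λ k → k + suc k) (length-stage v d m))

0<len-suc : ∀ m → 0 < len (suc m)
0<len-suc m = <-≤-trans z<s (m≤n+m (suc (len m)) (len m))

period-mono : m ≤ N → period m ≤ period N
period-mono z≤n       = s≤s z≤n
period-mono (s≤s m≤N) = +-mono-≤ (period-mono m≤N) (period-mono m≤N)

period-+ : ∀ k m → period (k + m) ≡ 2 ^ k * period m
period-+ zero    m = sym (+-identityʳ (period m))
period-+ (suc k) m = trans (cong (λ P → P + P) (period-+ k m)) (double (2 ^ k) (period m))
  where
  double : ∀ a b → a * b + a * b ≡ 2 * a * b
  double = solve-∀

grow-left : ∀ x c l → listAt l j ≡ just b → listAt (grow x c l) j ≡ just (complementIf (not c) b)
grow-left x true  l q = listAt-++ˡ l q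
grow-left x false l q = listAt-++ˡ (map comp l) (listAt-map comp l q)

grow-right : ∀ x c l → listAt l j ≡ just b → listAt (grow x c l) (length l + suc j) ≡ just (complementIf c b)
grow-right {j = j} x true  l q = trans (listAt-++ʳ l (suc j)) (listAt-map comp l q)
grow-right {j = j} x false l q =
  subst (λ L → listAt (map comp l ++ x ∷ l) (L + suc j) ≡ _) (length-map comp l)
        (trans (listAt-++ʳ (map comp l) (suc j)) q)

grow-middle : ∀ x c l → listAt (grow x c l) (length l) ≡ just x
grow-middle x true  l = subst (λ i → listAt (grow x true l) i ≡ _) (+-identityʳ (length l)) (listAt-++ʳ l 0)
grow-middle x false l =
  subst (λ i → listAt (grow x false l) i ≡ _) (trans (+-identityʳ _) (length-map comp l)) (listAt-++ʳ (map comp l) 0)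

record Occurs (W : List Bit) (v : ℕ → Bit) (d : ℕ → Bool) (m p : ℕ) (e : Bool) : Set where
  constructor occurs
  field
    at : ∀ j {b} → listAt (stage v d m) j ≡ just b → listAt W (p + j) ≡ just (complementIf e b)
open Occurs

occurs-at : p ≡ s → Occurs W v d m p e → Occurs W v d m s e
occurs-at refl O = O

occurs-refl : Occurs (stage v d m) v d m 0 false
occurs-refl = occurs λ j q → q

occurs-left : Occurs W v d (suc m) p e → Occurs W v d m p (flipUnless (d m) e)
occurs-left {v = v} {d = d} {m = m} {e = e} O =
  occurs λ j q → trans (at O j (grow-left (v m) (d m) _ q)) (cong just (complementIf-flipUnless (d m) e _))

occurs-right : Occurs W v d (suc m) p e → Occurs W v d m (p + period m) (not (flipUnless (d m) e))
occurs-right {W = W} {v = v} {d = d} {m = m} {p = p} {e = e} O = occurs λ j {b} q →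
  subst (λ i → listAt W i ≡ just (complementIf (not (flipUnless (d m) e)) b)) (index j)
        (trans (at O (len m + suc j) (subst (λ L → listAt (stage v d (suc m)) (L + suc j) ≡ _)
                                             (length-stage v d m) (grow-right (v m) (d m) _ q)))
               (cong just (complementIf-not-flipUnless (d m) e _)))
  where
  index : ∀ j → p + (len m + suc j) ≡ p + period m + j
  index j = trans (cong (λ n → p + n) (+-suc (len m) j)) (sym (+-assoc p (period m) j))

occurs-middle : Occurs W v d (suc m) p e → listAt W (p + len m) ≡ just (complementIf e (v m))
occurs-middle {v = v} {d = d} {m = m} O =
  at O (len m) (subst (λ i → listAt (stage v d (suc m)) i ≡ _) (length-stage v d m) (grow-middle (v m) (d m) _))

occurs-tiles : ∀ k → Occurs W v d (k + m) p e →
               ∀ i → i < 2 ^ k → ∃ λ e′ → Occurs W v d m (p + i * period m) e′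
occurs-tiles {p = p} zero O zero _ = _ , occurs-at (sym (+-identityʳ p)) O
occurs-tiles zero O (suc i) (s≤s ())
occurs-tiles (suc k) O i i<2^1+k with i <? 2 ^ k
... | yes i<2^k = occurs-tiles k (occurs-left O) i i<2^k
occurs-tiles {m = m} {p = p} (suc k) O i i<2^1+k | no i≮2^k
  with occurs-tiles k (occurs-right O) (i ∸ 2 ^ k) i∸2^k<2^k
  where
  i∸2^k<2^k : i ∸ 2 ^ k < 2 ^ k
  i∸2^k<2^k = +-cancelˡ-< (2 ^ k) (i ∸ 2 ^ k) (2 ^ k)
    (subst₂ _<_ (sym (m+[n∸m]≡n (≮⇒≥ i≮2^k))) (cong (λ n → 2 ^ k + n) (+-identityʳ (2 ^ k))) i<2^1+k)
... | e′ , O′ = e′ , occurs-at index O′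
  where
  open ≡-Reasoning
  index : p + period (k + m) + (i ∸ 2 ^ k) * period m ≡ p + i * period m
  index = begin
    p + period (k + m) + (i ∸ 2 ^ k) * period m     ≡⟨ cong (λ P → p + P + (i ∸ 2 ^ k) * period m) (period-+ k m) ⟩
    p + 2 ^ k * period m + (i ∸ 2 ^ k) * period m   ≡⟨ +-assoc p _ _ ⟩
    p + (2 ^ k * period m + (i ∸ 2 ^ k) * period m) ≡⟨ cong (λ n → p + n) (sym (*-distribʳ-+ (period m) (2 ^ k) _)) ⟩
    p + (2 ^ k + (i ∸ 2 ^ k)) * period m            ≡⟨ cong (λ n → p + n * period m) (m+[n∸m]≡n (≮⇒≥ i≮2^k)) ⟩
    p + i * period m                                ∎

occurs-polarity-unique : v 0 ≡ w 0 → ∀ m → Occurs W v d (suc m) p a → Occurs W w d (suc m) p c → a ≡ c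
occurs-polarity-unique {v = v} {c = c} v0≡w0 zero A C =
  complementIf-injectiveˡ (v 0)
    (trans (same-letter (occurs-middle A) (occurs-middle C)) (cong (complementIf c) (sym v0≡w0)))
occurs-polarity-unique {d = d} v0≡w0 (suc m) A C =
  flipUnless-injective (d (suc m)) (occurs-polarity-unique v0≡w0 m (occurs-left A) (occurs-left C))

occurs-separator-unique : v 0 ≡ w 0 → ∀ m → Occurs W v d (suc m) p a → Occurs W w d (suc m) p c → v m ≡ w m
occurs-separator-unique {a = a} {c = c} v0≡w0 m A C with occurs-polarity-unique {a = a} {c = c} v0≡w0 m A C
... | refl = complementIf-injectiveʳ c (same-letter (occurs-middle A) (occurs-middle C))

-- Alignment of an occurrence with the tiles

even-or-odd : ∀ n → ∃ λ h → n ≡ h + h ⊎ n ≡ suc (h + h)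
even-or-odd zero    = 0 , inj₁ refl
even-or-odd (suc n) with even-or-odd n
... | h , inj₁ refl = h , inj₂ refl
... | h , inj₂ refl = suc h , inj₁ (cong suc (sym (+-suc h h)))

private
  s+Q≡t : ∀ h Q → suc (h + h) * Q + Q ≡ suc h * (Q + Q)
  s+Q≡t = solve-∀
  s+2Q≡t+Q : ∀ h Q → suc (h + h) * Q + (Q + Q) ≡ suc h * (Q + Q) + Q
  s+2Q≡t+Q = solve-∀
  s+2Q+l≡t+l+Q : ∀ h Q l → suc (h + h) * Q + (Q + Q) + l ≡ suc h * (Q + Q) + (l + Q)
  s+2Q+l≡t+l+Q = solve-∀
  halve : ∀ h Q → (h + h) * Q ≡ h * (Q + Q)
  halve = solve-∀

module InStage (w : ℕ → Bit) (d : ℕ → Bool) (N : ℕ) where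

  stage-tile : ∀ i m → i * period m + len m < len N → ∃ λ e → Occurs (stage w d N) w d m (i * period m) e
  stage-tile i m fits =
    occurs-tiles k (subst (λ M → Occurs (stage w d N) w d M 0 false) N≡k+m occurs-refl) i i<2^k
    where
    open ≤-Reasoning
    period-m<period-N : period m < period N
    period-m<period-N = begin-strict
      period m                   ≤⟨ s≤s (m≤n+m (len m) (i * period m)) ⟩
      suc (i * period m + len m) ≤⟨ fits ⟩
      len N                      <⟨ n<1+n (len N) ⟩
      period N                   ∎
    m≤N : m ≤ N
    m≤N with m ≤? N
    ... | yes m≤N = m≤N
    ... | no  m≰N = contradiction (period-mono (<⇒≤ (≰⇒> m≰N))) (<⇒≱ period-m<period-N)
    k = N ∸ m
    N≡k+m : N ≡ k + m
    N≡k+m = sym (m∸n+n≡m m≤N)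
    i<2^k : i < 2 ^ k
    i<2^k = *-cancelʳ-< (period m) i (2 ^ k) (begin-strict
      i * period m         ≤⟨ m≤m+n (i * period m) (len m) ⟩
      i * period m + len m <⟨ fits ⟩
      len N                <⟨ n<1+n (len N) ⟩
      period N             ≡⟨ cong period N≡k+m ⟩
      period (k + m)       ≡⟨ period-+ k m ⟩
      2 ^ k * period m     ∎)

  listAt-stage⇒< : listAt (stage w d N) i ≡ just b → i < len N
  listAt-stage⇒< q = subst (_ <_) (length-stage w d N) (listAt-just⇒< (stage w d N) q)

  -- The two middle tiles w_{m+1} of w_{m+3} have the same polarity, whereas at an
  -- odd multiple of 2^{m+1} they would cover the two halves of a tile w_{m+2} of w_N.
  odd-multiple-offset : v 0 ≡ w 0 → ∀ m h →
    ¬ Occurs (stage w d N) v d (3 + m) (suc (h + h) * period (suc m)) e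
  odd-multiple-offset {v = v} {e = e} v0≡w0 m h O =
    not-¬ refl (trans (sym left-tiles) right-tiles)
    where
    Q = period (suc m)
    A = occurs-left O
    B = occurs-right O
    α = flipUnless (d (2 + m)) e
    β = flipUnless (d (suc m)) α
    tile : ∃ λ κ → Occurs (stage w d N) w d (2 + m) (suc h * period (2 + m)) κ
    tile = stage-tile (suc h) (2 + m)
      (subst (_< len N) (s+2Q+l≡t+l+Q h Q (len (suc m))) (listAt-stage⇒< (occurs-middle B)))
    γ = flipUnless (d (suc m)) (proj₁ tile)
    left-tiles : not β ≡ γ
    left-tiles = occurs-polarity-unique v0≡w0 m
      (occurs-at (s+Q≡t h Q) (occurs-right A)) (occurs-left (proj₂ tile))
    right-tiles : not β ≡ not γ
    right-tiles = trans (sym (flipUnless-not (d (suc m)) α)) (occurs-polarity-unique v0≡w0 m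
      (occurs-at (s+2Q≡t+Q h Q) (occurs-left B)) (occurs-right (proj₂ tile)))

  doubling : v 0 ≡ w 0 → ∀ m → Occurs (stage w d N) v d (3 + m) s e → period (suc m) ∣ s → period (2 + m) ∣ s
  doubling v0≡w0 m O (divides q refl) with even-or-odd q
  ... | h , inj₁ refl = divides h (halve h (period (suc m)))
  ... | h , inj₂ refl = ⊥-elim (odd-multiple-offset v0≡w0 m h O)

-- The seed 001 = χ^f_0 is w_2, grown from the empty word with separators 0, 0.

separators : (ℕ → Bit) → ℕ → Bit
separators f zero          = b0
separators f (suc zero)    = b0
separators f (suc (suc n)) = f n

directions : ℕ → Bool
directions zero          = true
directions (suc zero)    = true
directions (suc (suc n)) = isEven n

word : (ℕ → Bit) → ℕ → List Bit
word f = stage (separators f) directions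

seed-unshiftable : ∀ f g → Occurs W (separators f) directions 2 p c → ¬ Occurs W (separators g) directions 2 (suc p) e
seed-unshiftable {W = W} {p = p} {c = c} {e = e} f g A B
  with complementIf-injectiveʳ c (trans letter₁ (sym letter₂))
  where
  shifted : ∀ j → listAt W (suc p + j) ≡ just (complementIf e b0) → listAt W (p + suc j) ≡ just (complementIf e b0)
  shifted j = subst (λ i → listAt W i ≡ just (complementIf e b0)) (sym (+-suc p j))
  letter₁ : complementIf c b0 ≡ complementIf e b0
  letter₁ = same-letter (at A 1 refl) (shifted 0 (at B 0 refl))
  letter₂ : complementIf c b1 ≡ complementIf e b0
  letter₂ = same-letter (at A 2 refl) (shifted 1 (at B 1 refl))
... | ()

private
  s≡1+4u : ∀ u → suc ((u + u) + (u + u)) ≡ suc (u * 4)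
  s≡1+4u = solve-∀
  s+2≡4u+3 : ∀ u → suc ((u + u) + (u + u)) + 2 ≡ u * 4 + 3
  s+2≡4u+3 = solve-∀
  4[u+1]≡s+1 : ∀ u → suc u * 4 ≡ suc (suc (suc (u + u) + suc (u + u)))
  4[u+1]≡s+1 = solve-∀
  s+4≡4[u+1]+3 : ∀ u → suc (suc (u + u) + suc (u + u)) + 4 ≡ suc u * 4 + 3
  s+4≡4[u+1]+3 = solve-∀
  twice : ∀ h → h + h ≡ h * 2
  twice = solve-∀

module _ (f g : ℕ → Bit) (N : ℕ) where
  open InStage (separators g) directions N

  offset-even : Occurs (word g N) (separators f) directions 3 s e → 2 ∣ s
  offset-even {s = s} O with even-or-odd s
  ... | h , inj₁ refl = divides h (twice h)
  ... | h , inj₂ refl with even-or-odd h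
  offset-even O | _ , inj₂ refl | u , inj₁ refl =
    ⊥-elim (seed-unshiftable g f (proj₂ tile) (occurs-at (s≡1+4u u) (occurs-left O)))
    where
    tile : ∃ λ c → Occurs (word g N) (separators g) directions 2 (u * 4) c
    tile = stage-tile u 2 (subst (_< len N) (s+2≡4u+3 u) (listAt-stage⇒< (at O 2 refl)))
  offset-even O | _ , inj₂ refl | u , inj₂ refl =
    ⊥-elim (seed-unshiftable f g (occurs-left O) (occurs-at (4[u+1]≡s+1 u) (proj₂ tile)))
    where
    tile : ∃ λ c → Occurs (word g N) (separators g) directions 2 (suc u * 4) c
    tile = stage-tile (suc u) 2 (subst (_< len N) (s+4≡4[u+1]+3 u) (listAt-stage⇒< (at O 4 refl)))

  aligned : ∀ m → Occurs (word g N) (separators f) directions (3 + m) s e → period (2 + m) ∣ s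
  aligned zero    O = doubling refl 0 O (offset-even O)
  aligned (suc m) O = doubling refl (suc m) O (aligned m (occurs-left O))

  occurs⇒agree : ∀ n → Occurs (word g N) (separators f) directions (4 + n) s e → f n ≡ g n
  occurs⇒agree {s = s} n O with aligned {s = s} (suc n) O
  ... | divides q refl = occurs-separator-unique refl (2 + n) (occurs-left O)
    (proj₂ (stage-tile q (3 + n) (listAt-stage⇒< (occurs-middle O))))

-- From finite covering to an occurrence of words

proj₂-step : ∀ x c B → proj₂ (step x c B) ≡ grow x c (proj₂ B)
proj₂-step x true  B = refl
proj₂-step x false B = refl

chiStage-word : ∀ f m → proj₂ (chiStage f m) ≡ word f (2 + m)
chiStage-word f zero    = refl
chiStage-word f (suc m) =
  trans (proj₂-step (f m) (isEven m) (chiStage f m)) (cong (grow (f m) (isEven m)) (chiStage-word f m))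

blockAt-offset : ∀ a l z → z ℤ.- a ≡ + i → blockAt (a , l) z ≡ listAt l i
blockAt-offset a l z eq with z ℤ.- a
blockAt-offset a l z refl | .(+ _) = refl

blockAt-just : ∀ a l z → blockAt (a , l) z ≡ just b → ∃ λ i → z ℤ.- a ≡ + i × listAt l i ≡ just b
blockAt-just a l z q with z ℤ.- a
... | + i = i , refl , q
blockAt-just a l z () | -[1+ _ ]

Is-just⇒just : ∀ {m : Maybe Bit} → Is-just m → ∃ λ b → m ≡ just b
Is-just⇒just (just {x = b} _) = b , refl

just⇒Is-just : ∀ {m : Maybe Bit} → m ≡ just b → Is-just m
just⇒Is-just refl = just tt

blockAt-Is-just : ∀ a l z → Is-just (blockAt (a , l) z) → ∃ λ i → z ℤ.- a ≡ + i × i < length l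
blockAt-Is-just a l z J with blockAt-just a l z (proj₂ (Is-just⇒just J))
... | i , off , q = i , off , listAt-just⇒< l q

between : + i ℤ.≤ z → z ℤ.≤ + N → ∃ λ j → z ≡ + j × j ≤ N
between {z = + j} _ (+≤+ j≤N) = j , refl , j≤N

blockAt-finite : ∀ B → FiniteSeq (blockAt B)
blockAt-finite (a , l) = interval , ℤ.∣ a ∣ + length l , bounded
  where
  interval : IntervalDomain (blockAt (a , l))
  interval z₁ z₂ z₃ z₁≤z₂ z₂≤z₃ J₁ J₃ with blockAt-Is-just a l z₁ J₁ | blockAt-Is-just a l z₃ J₃
  ... | i , off₁ , _ | k , off₃ , k<l
    with between (subst (ℤ._≤ _) off₁ (ℤₚ.+-monoˡ-≤ (ℤ.- a) z₁≤z₂)) (subst (_ ℤ.≤_) off₃ (ℤₚ.+-monoˡ-≤ (ℤ.- a) z₂≤z₃))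
  ... | j , off₂ , j≤k =
    just⇒Is-just (trans (blockAt-offset a l z₂ off₂) (proj₂ (<⇒listAt-just l (≤-<-trans j≤k k<l))))
  recentre : ∀ z a → z ≡ a ℤ.+ (z ℤ.- a)
  recentre = ℤ-Solver.solve-∀
  bounded : ∀ z → Is-just (blockAt (a , l) z) → ℤ.∣ z ∣ ≤ ℤ.∣ a ∣ + length l
  bounded z J with blockAt-Is-just a l z J
  ... | i , off , i<l = begin
    ℤ.∣ z ∣                     ≡⟨ cong ℤ.∣_∣ (recentre z a) ⟩
    ℤ.∣ a ℤ.+ (z ℤ.- a) ∣       ≤⟨ ℤₚ.∣i+j∣≤∣i∣+∣j∣ a (z ℤ.- a) ⟩
    ℤ.∣ a ∣ + ℤ.∣ z ℤ.- a ∣     ≡⟨ cong (λ t → ℤ.∣ a ∣ + ℤ.∣ t ∣) off ⟩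
    ℤ.∣ a ∣ + i                 ≤⟨ +-monoʳ-≤ ℤ.∣ a ∣ (<⇒≤ i<l) ⟩
    ℤ.∣ a ∣ + length l          ∎
    where open ≤-Reasoning

blockAt-step : ∀ x c B z → blockAt B z ≡ just b → blockAt (step x c B) z ≡ just b
blockAt-step x true (a , l) z q with blockAt-just a l z q
... | i , off , r = trans (blockAt-offset a (l ++ x ∷ map comp l) z off) (listAt-++ˡ l r)
blockAt-step x false (a , l) z q with blockAt-just a l z q
... | i , off , r =
  trans (blockAt-offset a′ (map comp l ++ x ∷ l) z off′) (trans (listAt-++ʳ (map comp l) (suc i)) r)
  where
  a′ = (a ℤ.- + length l) ℤ.- + 1
  shift : ∀ z a L → z ℤ.- ((a ℤ.- L) ℤ.- ℤ.1ℤ) ≡ L ℤ.+ (ℤ.1ℤ ℤ.+ (z ℤ.- a))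
  shift = ℤ-Solver.solve-∀
  off′ : z ℤ.- a′ ≡ + (length (map comp l) + suc i)
  off′ = trans (shift z a (+ length l))
               (trans (cong (λ t → + length l ℤ.+ (+ 1 ℤ.+ t)) off)
                      (cong (λ L → + (L + suc i)) (sym (length-map comp l))))

chiStage-extends : ∀ g M z t → blockAt (chiStage g M) z ≡ just b → blockAt (chiStage g (t + M)) z ≡ just b
chiStage-extends g M z zero    q = q
chiStage-extends g M z (suc t) q =
  blockAt-step (g (t + M)) (isEven (t + M)) (chiStage g (t + M)) z (chiStage-extends g M z t q)

chiStage-mono : ∀ g z → M ≤ M′ → blockAt (chiStage g M) z ≡ just b → blockAt (chiStage g M′) z ≡ just b
chiStage-mono {M = M} {M′ = M′} {b = b} g z M≤M′ q =
  subst (λ K → blockAt (chiStage g K) z ≡ just b) (m∸n+n≡m M≤M′) (chiStage-extends g M z (M′ ∸ M) q)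

common-witness : {Q : ℕ → ℕ → Set} → (∀ {j M M′} → M ≤ M′ → Q j M → Q j M′) →
                 (∀ j → ∃ (Q j)) → ∀ J → ∃ λ M → ∀ j → j < J → Q j M
common-witness mono witness zero = 0 , λ _ ()
common-witness {Q = Q} mono witness (suc J) with common-witness mono witness J | witness J
... | M , below | M′ , atJ = M ⊔ M′ , upTo
  where
  upTo : ∀ j → j < suc J → Q j (M ⊔ M′)
  upTo j j<1+J with m<1+n⇒m<n∨m≡n j<1+J
  ... | inj₁ j<J  = mono (m≤m⊔n M M′) (below j j<J)
  ... | inj₂ refl = mono (m≤n⊔m M M′) atJ

InfixAt : List Bit → List Bit → ℕ → Set
InfixAt V W s = ∀ j {b} → listAt V j ≡ just b → listAt W (s + j) ≡ just b

translate⇒infix : ∀ a c W V → 0 < length V →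
  (∀ j {b} → listAt V j ≡ just b → blockAt (a , W) (c ℤ.+ + j) ≡ just b) → ∃ λ s → InfixAt V W s
translate⇒infix a c W V nonempty E with <⇒listAt-just V nonempty
... | _ , v₀ with blockAt-just a W (c ℤ.+ + 0) (E 0 v₀)
... | s , off₀ , _ = s , λ j q → trans (sym (blockAt-offset a W (c ℤ.+ + j) (offset j))) (E j q)
  where
  recentre : ∀ c a x → (c ℤ.+ x) ℤ.- a ≡ ((c ℤ.+ ℤ.0ℤ) ℤ.- a) ℤ.+ x
  recentre = ℤ-Solver.solve-∀
  offset : ∀ j → (c ℤ.+ + j) ℤ.- a ≡ + (s + j)
  offset j = trans (recentre c a (+ j)) (cong (ℤ._+ + j) off₀)

embedding⇒infix : ∀ g a V → 0 < length V → EmbChi (blockAt (a , V)) g →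
                  ∃₂ λ N s → InfixAt V (proj₂ (chiStage g N)) s
embedding⇒infix g a V nonempty (k , H) =
  let (N , found) = common-witness {Q = Found} mono witness (length V)
  in N , translate⇒infix (proj₁ (chiStage g N)) (a ℤ.- k) (proj₂ (chiStage g N)) V nonempty
                         (λ j q → found j (listAt-just⇒< V q) q)
  where
  Found : ℕ → ℕ → Set
  Found j M = ∀ {b} → listAt V j ≡ just b → blockAt (chiStage g M) ((a ℤ.- k) ℤ.+ + j) ≡ just b
  mono : ∀ {j M M′} → M ≤ M′ → Found j M → Found j M′
  mono {j} M≤M′ found q = chiStage-mono g ((a ℤ.- k) ℤ.+ + j) M≤M′ (found q)
  cancel : ∀ a k x → ((a ℤ.- k) ℤ.+ x) ℤ.+ k ≡ a ℤ.+ x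
  cancel = ℤ-Solver.solve-∀
  offset : ∀ a x → (a ℤ.+ x) ℤ.- a ≡ x
  offset = ℤ-Solver.solve-∀
  letter : ∀ j {b} → listAt V j ≡ just b → ChiGraph g ((a ℤ.- k) ℤ.+ + j) b
  letter j {b} q = H ((a ℤ.- k) ℤ.+ + j) b
    (trans (cong (blockAt (a , V)) (cancel a k (+ j))) (trans (blockAt-offset a V (a ℤ.+ + j) (offset a (+ j))) q))
  witness : ∀ j → ∃ (Found j)
  witness j with listAt V j in q
  ... | nothing = 0 , λ ()
  ... | just b  = let (M , r) = letter j q in M , λ { refl → r }

chiStage-nonempty : ∀ f m → 0 < length (proj₂ (chiStage f m))
chiStage-nonempty f m = subst (λ V → 0 < length V) (sym (chiStage-word f m))
  (subst (0 <_) (sym (length-stage (separators f) directions (2 + m))) (0<len-suc (suc m)))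

covered⇒occurs : FinCovered f g → ∀ m → ∃₂ λ N s → Occurs (word g (2 + N)) (separators f) directions (2 + m) s false
covered⇒occurs {f = f} {g = g} covered m =
  let (N , s , V≤W) = embedding⇒infix g (proj₁ (chiStage f m)) (proj₂ (chiStage f m)) (chiStage-nonempty f m)
                        (covered (blockAt (chiStage f m)) (blockAt-finite (chiStage f m)) (λ _ _ q → m , q))
  in N , s , occurs (subst₂ (λ V W → InfixAt V W s) (chiStage-word f m) (chiStage-word g N) V≤W)

lemma8p11 : (f g : ℕ → Bit) → ¬ (∀ n → f n ≡ g n) → ¬ FinCovered f g
lemma8p11 f g f≢g covered = f≢g agree
  where
  agree : ∀ n → f n ≡ g n
  agree n = let (N , _ , O) = covered⇒occurs covered (2 + n) in occurs⇒agree f g (2 + N) n O
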